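{- Let $R$ be an $\omega$-algebraic lattice and let $D,C$ be the inverse-limit solutions of $D=[C\to R]$, $C=D\times C$ described below. For each $A\in\{R,D,C\}$, the lattice $(\mathcal F_A,\subseteq)$ of filters over $(\mathcal L_A,\le_A)$ is isomorphic (as an $\omega$-algebraic lattice) to $A$.
   Context: Domains. $R$ is an $\omega$-algebraic lattice (complete lattice whose compact elements $\mathcal K(R)$ are countable and generate every element as a directed join). Put $C_0=\{\bot\}$, $D_n=[C_n\to R]$ (Scott-continuous functions, ordered pointwise) and $C_{n+1}=D_n\times C_n$. With the standard embedding-projection pairs these are projective sequences, and $D=\varprojlim D_n$, $C=\varprojlim C_n$ are the inverse limits. Type languages: - $\mathcal L_R$: $\rho::=\psi_a\mid\omega\mid\rho\wedge\rho$ with $a\in\mathcal K(R)$; - $\mathcal L_D$: $\delta::=\rho\mid\kappa\to\rho\mid\omega\mid\delta\wedge\delta$ with $\rho\in\mathcal L_R$; - $\mathcal L_C$: $\kappa::=\delta\times\kappa\mid\omega\mid\kappa\wedge\kappa$. Preorders. $\le_R,\le_D,\le_C$ are the least preorders on these languages such that, in each sort: - $\sigma\wedge\tau\le\sigma$, $\sigma\wedge\tau\le\tau$, $\sigma\le\omega$, and ($\rho\le\sigma$ and $\rho\le\tau$) implies $\rho\le\sigma\wedge\tau$. In addition: - $\psi_\bot\sim_R\omega$ and $\psi_{a\sqcup b}\sim_R\psi_a\wedge\psi_b$; - $\rho_1\le_R\rho_2$ implies $\rho_1\le_D\rho_2$; - $\omega\le_D\omega\to\omega$; $\psi_a\le_D\omega\to\psi_a$;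 $\omega\to\psi_a\le_D\psi_a$; $\omega\le_C\omega\times\omega$; - $(\kappa\to\rho_1)\wedge(\kappa\to\rho_2)\le_D\kappa\to(\rho_1\wedge\rho_2)$; - $(\delta_1\times\kappa_1)\wedge(\delta_2\times\kappa_2)\le_C(\delta_1\wedge\delta_2)\times(\kappa_1\wedge\kappa_2)$; - $\kappa_2\le_C\kappa_1$ and $\rho_1\le_R\rho_2$ imply $\kappa_1\to\rho_1\le_D\kappa_2\to\rho_2$; - $\delta_1\le_D\delta_2$ and $\kappa_1\le_C\kappa_2$ imply $\delta_1\times\kappa_1\le_C\delta_2\times\kappa_2$. Here $\sim$ means $\le$ in both directions. Filters. A (formal) filter over $(\mathcal L_A,\le_A)$ is a set $f\subseteq\mathcal L_A$ containing $\omega$, upward closed under $\le_A$, and closed under $\wedge$. $\mathcal F_A$ is the set of such filters, ordered by inclusion. -}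

module Defs where

open import Level using (Level; _⊔_; 0ℓ) renaming (suc to lsuc)
open import Data.Nat using (ℕ; zero; suc)
open import Data.Bool using (Bool; true; false)
open import Data.Empty using (⊥)
open import Data.Product using (Σ; _×_; _,_; proj₁; proj₂; Σ-syntax)
open import Relation.Binary.PropositionalEquality using (_≡_)

record CLat (ℓ : Level) : Set (lsuc (lsuc 0ℓ ⊔ ℓ)) where
  field
    Carrier : Set₁
    _⊑_     : Carrier → Carrier → Set ℓ
    ⊑-refl  : ∀ {x} → x ⊑ x
    ⊑-trans : ∀ {x y z} → x ⊑ y → y ⊑ z → x ⊑ z
    ⋁       : {I : Set} → (I → Carrier) → Carrier
    ⋁-ub    : ∀ {I} (x : I → Carrier) (i : I) → x i ⊑ ⋁ x
    ⋁-least : ∀ {I} (x : I → Carrier) {u} → (∀ i → x i ⊑ u) → ⋁ x ⊑ u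

  _≈_ : Carrier → Carrier → Set ℓ
  x ≈ y = (x ⊑ y) × (y ⊑ x)

open CLat

Directed : ∀ {ℓ} (A : CLat ℓ) {I : Set} → (I → Carrier A) → Set ℓ
Directed A {I} x =
  I × ((i j : I) → Σ[ k ∈ I ] ((_⊑_ A (x i) (x k)) × (_⊑_ A (x j) (x k))))

record IsScott {ℓa ℓb} (A : CLat ℓa) (B : CLat ℓb)
               (f : Carrier A → Carrier B) : Set (lsuc 0ℓ ⊔ ℓa ⊔ ℓb) where
  field
    mono : ∀ {a a'} → _⊑_ A a a' → _⊑_ B (f a) (f a')
    cont : ∀ {I : Set} (x : I → Carrier A) → Directed A x →
           _⊑_ B (f (⋁ A x)) (⋁ B (λ i → f (x i)))

open IsScott

ScottMap : ∀ {ℓa ℓb} → CLat ℓa → CLat ℓb → Set (lsuc 0ℓ ⊔ ℓa ⊔ ℓb)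
ScottMap A B = Σ (Carrier A → Carrier B) (IsScott A B)

data ⊤₁ : Set₁ where
  tt₁ : ⊤₁

unitCL : CLat (lsuc 0ℓ)
unitCL = record
  { Carrier = ⊤₁ ; _⊑_ = λ _ _ → ⊤₁ ; ⊑-refl = tt₁ ; ⊑-trans = λ _ _ → tt₁
  ; ⋁ = λ _ → tt₁ ; ⋁-ub = λ _ _ → tt₁ ; ⋁-least = λ _ _ → tt₁ }

_×CL_ : ∀ {ℓa ℓb} → CLat ℓa → CLat ℓb → CLat (ℓa ⊔ ℓb)
A ×CL B = record
  { Carrier = Carrier A × Carrier B
  ; _⊑_ = λ p q → (_⊑_ A (proj₁ p) (proj₁ q)) × (_⊑_ B (proj₂ p) (proj₂ q))
  ; ⊑-refl = ⊑-refl A , ⊑-refl B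
  ; ⊑-trans = λ p q → ⊑-trans A (proj₁ p) (proj₁ q) , ⊑-trans B (proj₂ p) (proj₂ q)
  ; ⋁ = λ x → ⋁ A (λ i → proj₁ (x i)) , ⋁ B (λ i → proj₂ (x i))
  ; ⋁-ub = λ x i → ⋁-ub A (λ i → proj₁ (x i)) i , ⋁-ub B (λ i → proj₂ (x i)) i
  ; ⋁-least = λ x h → ⋁-least A (λ i → proj₁ (x i)) (λ i → proj₁ (h i))
                    , ⋁-least B (λ i → proj₂ (x i)) (λ i → proj₂ (h i))
  }

⋁⇒ : (A : CLat (lsuc 0ℓ)) (B : CLat 0ℓ) {I : Set} →
     (I → ScottMap A B) → ScottMap A B
⋁⇒ A B g =
  (λ a → ⋁ B (λ k → proj₁ (g k) a)) ,
  record
    { mono = λ a⊑a' → ⋁-least B _ (λ k →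
               ⊑-trans B (mono (proj₂ (g k)) a⊑a') (⋁-ub B (λ k → proj₁ (g k) _) k))
    ; cont = λ x d → ⋁-least B _ (λ k →
               ⊑-trans B (cont (proj₂ (g k)) x d)
                 (⋁-least B _ (λ i →
                    ⊑-trans B (⋁-ub B (λ k → proj₁ (g k) (x i)) k)
                              (⋁-ub B (λ i → ⋁ B (λ k → proj₁ (g k) (x i))) i))))
    }

-- Scott function space [A → B], ordered pointwise
-- (only needed for A = C_n and B = R, which fixes the universe levels)
[_⇒_] : CLat (lsuc 0ℓ) → CLat 0ℓ → CLat (lsuc 0ℓ)
[ A ⇒ B ] = record
  { Carrier = ScottMap A B
  ; _⊑_ = λ f g → (a : Carrier A) → _⊑_ B (proj₁ f a) (proj₁ g a)
  ; ⊑-refl = λ a → ⊑-refl B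
  ; ⊑-trans = λ p q a → ⊑-trans B (p a) (q a)
  ; ⋁ = ⋁⇒ A B
  ; ⋁-ub = λ x i a → ⋁-ub B (λ k → proj₁ (x k) a) i
  ; ⋁-least = λ x h a → ⋁-least B _ (λ i → h i a)
  }

constS : ∀ {ℓa ℓb} (A : CLat ℓa) (B : CLat ℓb) → Carrier B → ScottMap A B
constS A B c = (λ _ → c) , record
  { mono = λ _ → ⊑-refl B
  ; cont = λ x d → ⋁-ub B (λ _ → c) (proj₁ d) }

directed-map : ∀ {ℓa ℓb} (A : CLat ℓa) (B : CLat ℓb) (f : ScottMap A B)
               {I : Set} (x : I → Carrier A) → Directed A x →
               Directed B (λ i → proj₁ f (x i))
directed-map A B f x (i₀ , up) =
  i₀ , λ i j → let (k , p , q) = up i j in k , mono (proj₂ f) p , mono (proj₂ f) q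

precomp : (A : CLat (lsuc 0ℓ)) (B : CLat (lsuc 0ℓ)) (T : CLat 0ℓ) →
          ScottMap A B → ScottMap [ B ⇒ T ] [ A ⇒ T ]
precomp A B T h =
  (λ g → (λ a → proj₁ g (proj₁ h a)) , record
     { mono = λ p → mono (proj₂ g) (mono (proj₂ h) p)
     ; cont = λ x d → ⊑-trans T (mono (proj₂ g) (cont (proj₂ h) x d))
                        (cont (proj₂ g) (λ i → proj₁ h (x i)) (directed-map A B h x d)) })
  , record
     { mono = λ p a → p (proj₁ h a)
     ; cont = λ x d a → ⊑-refl T }

×S : ∀ {ℓa ℓb ℓc ℓd} (A : CLat ℓa) (B : CLat ℓb) (A' : CLat ℓc) (B' : CLat ℓd) →
     ScottMap A A' → ScottMap B B' → ScottMap (A ×CL B) (A' ×CL B')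
×S A B A' B' f g =
  (λ p → proj₁ f (proj₁ p) , proj₁ g (proj₂ p)) , record
    { mono = λ q → mono (proj₂ f) (proj₁ q) , mono (proj₂ g) (proj₂ q)
    ; cont = λ x d →
        cont (proj₂ f) (λ i → proj₁ (x i)) (proj₁ d , λ i j →
          let (k , p , q) = proj₂ d i j in k , proj₁ p , proj₁ q)
      , cont (proj₂ g) (λ i → proj₂ (x i)) (proj₁ d , λ i j →
          let (k , p , q) = proj₂ d i j in k , proj₂ p , proj₂ q)
    }

module _ (L : CLat 0ℓ) where
  IsCompact : Carrier L → Set₁
  IsCompact a = ∀ {I : Set} (x : I → Carrier L) → Directed L x →
                _⊑_ L a (⋁ L x) → Σ[ i ∈ I ] (_⊑_ L a (x i))

record OmegaAlgLattice : Set₂ where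
  field
    lat       : CLat 0ℓ
  field
    antisym   : ∀ {x y} → _⊑_ lat x y → _⊑_ lat y x → x ≡ y
    enum         : ℕ → Carrier lat
    enum-compact : ∀ n → IsCompact lat (enum n)
    enum-onto    : ∀ a → IsCompact lat a → Σ[ n ∈ ℕ ] (enum n ≡ a)
    algebraic : ∀ a → Σ[ I ∈ Set ] Σ[ x ∈ (I → Carrier lat) ]
                  ((∀ i → IsCompact lat (x i)) × Directed lat x × (a ≡ ⋁ lat x))

-- Posets (as preordered sets, iso up to ≈) and order isomorphisms

record Pos (ℓ : Level) : Set (lsuc (lsuc 0ℓ ⊔ ℓ)) where
  field
    Elt : Set₁
    _≤_ : Elt → Elt → Set ℓ

record _≅o_ {ℓ₁ ℓ₂} (P : Pos ℓ₁) (Q : Pos ℓ₂) : Set (lsuc 0ℓ ⊔ ℓ₁ ⊔ ℓ₂) where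
  open Pos P renaming (Elt to A; _≤_ to _≤A_)
  open Pos Q renaming (Elt to B; _≤_ to _≤B_)
  field
    to      : A → B
    from    : B → A
    to-mono   : ∀ {x y} → x ≤A y → to x ≤B to y
    from-mono : ∀ {x y} → x ≤B y → from x ≤A from y
    from-to : ∀ x → (from (to x) ≤A x) × (x ≤A from (to x))
    to-from : ∀ y → (to (from y) ≤B y) × (y ≤B to (from y))

record Filter (L : Set₁) (_≤_ : L → L → Set₁) (top : L) (_∧_ : L → L → L) : Set₁ where
  field
    mem      : L → Set
    mem-top  : mem top
    mem-up   : ∀ {σ τ} → σ ≤ τ → mem σ → mem τ
    mem-∧    : ∀ {σ τ} → mem σ → mem τ → mem (σ ∧ τ)

FilterPos : (L : Set₁) (_≤_ : L → L → Set₁) (top : L) (_∧_ : L → L → L) → Pos (lsuc 0ℓ)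
FilterPos L _≤_ top _∧_ = record
  { Elt = Filter L _≤_ top _∧_
  ; _≤_ = λ f g → ∀ σ → Filter.mem f σ → Filter.mem g σ }

module Construction (RR : OmegaAlgLattice) where
  open OmegaAlgLattice RR using (lat)
  R : CLat 0ℓ
  R = lat
  open CLat R using () renaming (Carrier to |R|; _⊑_ to _⊑R_; ⋁ to ⋁R)

  ⊥R : |R|
  ⊥R = ⋁R {⊥} (λ ())

  two : |R| → |R| → Bool → |R|
  two a b true  = a
  two a b false = b

  _⊔R_ : |R| → |R| → |R|
  a ⊔R b = ⋁R (two a b)

  Cn : ℕ → CLat (lsuc 0ℓ)
  Cn zero    = unitCL
  Cn (suc n) = [ Cn n ⇒ R ] ×CL Cn n

  Dn : ℕ → CLat (lsuc 0ℓ)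
  Dn n = [ Cn n ⇒ R ]

  -- standard embedding-projection pairs  i_n : C_n → C_{n+1},  j_n : C_{n+1} → C_n
  -- i_0 ⊥ = (⊥,⊥), j_0 = const ⊥;
  -- i_{n+1}(d,c) = (d ∘ j_n , i_n c),  j_{n+1}(d,c) = (d ∘ i_n , j_n c)
  iC : ∀ n → ScottMap (Cn n) (Cn (suc n))
  jC : ∀ n → ScottMap (Cn (suc n)) (Cn n)
  iC zero    = constS unitCL (Cn 1) (constS unitCL R ⊥R , tt₁)
  iC (suc n) = ×S (Dn n) (Cn n) (Dn (suc n)) (Cn (suc n))
                  (precomp (Cn (suc n)) (Cn n) R (jC n)) (iC n)
  jC zero    = constS (Cn 1) unitCL tt₁
  jC (suc n) = ×S (Dn (suc n)) (Cn (suc n)) (Dn n) (Cn n)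
                  (precomp (Cn n) (Cn (suc n)) R (iC n)) (jC n)

  eD : ∀ n → ScottMap (Dn n) (Dn (suc n))
  eD n = precomp (Cn (suc n)) (Cn n) R (jC n)

  pD : ∀ n → ScottMap (Dn (suc n)) (Dn n)
  pD n = precomp (Cn n) (Cn (suc n)) R (iC n)

  Dlim : Set₁
  Dlim = Σ[ d ∈ ((n : ℕ) → Carrier (Dn n)) ]
           (∀ n → _≈_ (Dn n) (proj₁ (pD n) (d (suc n))) (d n))

  Clim : Set₁
  Clim = Σ[ c ∈ ((n : ℕ) → Carrier (Cn n)) ]
           (∀ n → _≈_ (Cn n) (proj₁ (jC n) (c (suc n))) (c n))

  RPos : Pos 0ℓ
  RPos = record { Elt = |R| ; _≤_ = _⊑R_ }

  DPos : Pos (lsuc 0ℓ)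
  DPos = record { Elt = Dlim
                ; _≤_ = λ d d' → ∀ n → _⊑_ (Dn n) (proj₁ d n) (proj₁ d' n) }

  CPos : Pos (lsuc 0ℓ)
  CPos = record { Elt = Clim
                ; _≤_ = λ c c' → ∀ n → _⊑_ (Cn n) (proj₁ c n) (proj₁ c' n) }

  data LR : Set₁ where
    ψ    : (a : |R|) → IsCompact R a → LR
    ωR   : LR
    _∧R_ : LR → LR → LR

  mutual
    -- L_D : δ ::= ρ | κ → ρ | ω | δ ∧ δ   (ρ ∈ L_R embedded via embR)
    data LD : Set₁ where
      ψD   : (a : |R|) → IsCompact R a → LD
      _↦_  : LC → LR → LD
      ωD   : LD
      _∧D_ : LD → LD → LD

    data LC : Set₁ where
      _⊗_  : LD → LC → LC
      ωC   : LC
      _∧C_ : LC → LC → LC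

  embR : LR → LD
  embR (ψ a p)    = ψD a p
  embR ωR         = ωD
  embR (ρ ∧R ρ')  = embR ρ ∧D embR ρ'

  data _≤R_ : LR → LR → Set₁ where
    reflR   : ∀ {ρ} → ρ ≤R ρ
    transR  : ∀ {ρ σ τ} → ρ ≤R σ → σ ≤R τ → ρ ≤R τ
    ∧-lR    : ∀ {σ τ} → (σ ∧R τ) ≤R σ
    ∧-rR    : ∀ {σ τ} → (σ ∧R τ) ≤R τ
    ≤ωR     : ∀ {σ} → σ ≤R ωR
    glbR    : ∀ {ρ σ τ} → ρ ≤R σ → ρ ≤R τ → ρ ≤R (σ ∧R τ)
    ψ⊥≤ω    : (p : IsCompact R ⊥R) → ψ ⊥R p ≤R ωR
    ω≤ψ⊥    : (p : IsCompact R ⊥R) → ωR ≤R ψ ⊥R p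
    ψ⊔≤     : ∀ {a b} (p : IsCompact R a) (q : IsCompact R b) (r : IsCompact R (a ⊔R b)) →
              ψ (a ⊔R b) r ≤R (ψ a p ∧R ψ b q)
    ≤ψ⊔     : ∀ {a b} (p : IsCompact R a) (q : IsCompact R b) (r : IsCompact R (a ⊔R b)) →
              (ψ a p ∧R ψ b q) ≤R ψ (a ⊔R b) r

  mutual
    data _≤D_ : LD → LD → Set₁ where
      reflD   : ∀ {δ} → δ ≤D δ
      transD  : ∀ {δ σ τ} → δ ≤D σ → σ ≤D τ → δ ≤D τ
      ∧-lD    : ∀ {σ τ} → (σ ∧D τ) ≤D σ
      ∧-rD    : ∀ {σ τ} → (σ ∧D τ) ≤D τ
      ≤ωD     : ∀ {σ} → σ ≤D ωD
      glbD    : ∀ {δ σ τ} → δ ≤D σ → δ ≤D τ → δ ≤D (σ ∧D τ)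
      liftR   : ∀ {ρ₁ ρ₂} → ρ₁ ≤R ρ₂ → embR ρ₁ ≤D embR ρ₂
      ω≤ω↦ω   : ωD ≤D (ωC ↦ ωR)
      ψ≤ω↦ψ   : ∀ {a} (p : IsCompact R a) → ψD a p ≤D (ωC ↦ ψ a p)
      ω↦ψ≤ψ   : ∀ {a} (p : IsCompact R a) → (ωC ↦ ψ a p) ≤D ψD a p
      ↦∧      : ∀ {κ ρ₁ ρ₂} → ((κ ↦ ρ₁) ∧D (κ ↦ ρ₂)) ≤D (κ ↦ (ρ₁ ∧R ρ₂))
      ↦mono   : ∀ {κ₁ κ₂ ρ₁ ρ₂} → κ₂ ≤C κ₁ → ρ₁ ≤R ρ₂ → (κ₁ ↦ ρ₁) ≤D (κ₂ ↦ ρ₂)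

    data _≤C_ : LC → LC → Set₁ where
      reflC   : ∀ {κ} → κ ≤C κ
      transC  : ∀ {κ σ τ} → κ ≤C σ → σ ≤C τ → κ ≤C τ
      ∧-lC    : ∀ {σ τ} → (σ ∧C τ) ≤C σ
      ∧-rC    : ∀ {σ τ} → (σ ∧C τ) ≤C τ
      ≤ωC     : ∀ {σ} → σ ≤C ωC
      glbC    : ∀ {κ σ τ} → κ ≤C σ → κ ≤C τ → κ ≤C (σ ∧C τ)
      ω≤ω⊗ω   : ωC ≤C (ωD ⊗ ωC)
      ⊗∧      : ∀ {δ₁ δ₂ κ₁ κ₂} → ((δ₁ ⊗ κ₁) ∧C (δ₂ ⊗ κ₂)) ≤C ((δ₁ ∧D δ₂) ⊗ (κ₁ ∧C κ₂))
      ⊗mono   : ∀ {δ₁ δ₂ κ₁ κ₂} → δ₁ ≤D δ₂ → κ₁ ≤C κ₂ → (δ₁ ⊗ κ₁) ≤C (δ₂ ⊗ κ₂)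

  FR : Pos (lsuc 0ℓ)
  FR = FilterPos LR _≤R_ ωR _∧R_

  FD : Pos (lsuc 0ℓ)
  FD = FilterPos LD _≤D_ ωD _∧D_

  FC : Pos (lsuc 0ℓ)
  FC = FilterPos LC _≤C_ ωC _∧C_

-- A type of R denotes a compact element, and a type of D or C denotes, at every finite stage n,
-- its least realiser: meets become joins and an arrow κ ↦ ρ becomes the step function
-- (κ ⇒ ⟦ρ⟧). The preorders are sound and complete for these denotations; completeness rests on
-- an inversion lemma (a compact element below the value of a realiser is already produced by
-- a single arrow above it), which needs compact elements below a ⊔ b to split along a and b.
-- A filter is then sent to the stagewise join of the realisers of its members, and a point of
-- the limit to the filter of types it satisfies at some stage; algebraicity of R, inherited by
-- every stage, makes these maps mutually inverse.

module Submission where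

open import Defs
open import Level using (0ℓ) renaming (suc to lsuc)
open import Data.Bool using (true; false; if_then_else_)
open import Data.Nat using (ℕ; zero; suc; _⊔_; _≤′_; ≤′-refl; ≤′-step; s≤s⁻¹)
import Data.Nat as Nat
open import Data.Nat.Properties using (≤⇒≤′; m≤m⊔n; m≤n⊔m)
import Data.Nat.Properties as Nat
open import Data.Product using (Σ; Σ-syntax; _×_; _,_; proj₁; proj₂)
open import Data.Sum using (_⊎_; inj₁; inj₂)
open import Data.Unit using (⊤; tt)
open import Relation.Binary.PropositionalEquality using (_≡_; refl; sym; subst)

open CLat using (Carrier; _≈_; ⊑-refl; ⊑-trans; ⋁; ⋁-ub; ⋁-least)
open IsScott

⊑-syntax : ∀ {ℓ} (A : CLat ℓ) → Carrier A → Carrier A → Set ℓ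
⊑-syntax = CLat._⊑_

syntax ⊑-syntax A x y = x ⊑⟨ A ⟩ y

⋁-⊑-⋁ : ∀ {ℓ} (A : CLat ℓ) {I J : Set} (x : I → Carrier A) (y : J → Carrier A) →
        (∀ i → Σ[ j ∈ J ] x i ⊑⟨ A ⟩ y j) → ⋁ A x ⊑⟨ A ⟩ ⋁ A y
⋁-⊑-⋁ A x y below = ⋁-least A x λ i → ⊑-trans A (proj₂ (below i)) (⋁-ub A y (proj₁ (below i)))

directed-proj₁ : ∀ {ℓa ℓb} (A : CLat ℓa) (B : CLat ℓb) {I : Set} (x : I → Carrier (A ×CL B)) →
                 Directed (A ×CL B) x → Directed A (λ i → proj₁ (x i))
directed-proj₁ A B x (i₀ , up) = i₀ , λ i j → let (k , (p , _) , (q , _)) = up i j in k , p , q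

directed-proj₂ : ∀ {ℓa ℓb} (A : CLat ℓa) (B : CLat ℓb) {I : Set} (x : I → Carrier (A ×CL B)) →
                 Directed (A ×CL B) x → Directed B (λ i → proj₂ (x i))
directed-proj₂ A B x (i₀ , up) = i₀ , λ i j → let (k , (_ , p) , (_ , q)) = up i j in k , p , q

directed-app : (A : CLat (lsuc 0ℓ)) (B : CLat 0ℓ) {I : Set} (f : I → Carrier [ A ⇒ B ]) →
               Directed [ A ⇒ B ] f → ∀ a → Directed B (λ i → proj₁ (f i) a)
directed-app A B f (i₀ , up) a = i₀ , λ i j → let (k , p , q) = up i j in k , p a , q a

-- A type language interpreted at every stage of an inverse sequence of lattices: sat n x τ says
-- that x satisfies τ at stage n, and sem n τ is the least such x once n is large enough.
record LimitModel : Set₂ where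
  field
    L   : ℕ → CLat (lsuc 0ℓ)
    emb : ∀ n → ScottMap (L n) (L (suc n))
    prj : ∀ n → ScottMap (L (suc n)) (L n)
    emb∘prj⊑id : ∀ n x → proj₁ (emb n) (proj₁ (prj n) x) ⊑⟨ L (suc n) ⟩ x

    Type    : Set₁
    _≤_     : Type → Type → Set₁
    ω       : Type
    _∧_     : Type → Type → Type
    ≤-trans : ∀ {ρ σ τ} → ρ ≤ σ → σ ≤ τ → ρ ≤ τ
    ∧-≤ˡ    : ∀ {σ τ} → (σ ∧ τ) ≤ σ
    ∧-≤ʳ    : ∀ {σ τ} → (σ ∧ τ) ≤ τ

    Code     : Set
    ⌜_⌝      : Code → Type
    encode   : Type → Code
    ≤-encode : ∀ τ → τ ≤ ⌜ encode τ ⌝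
    encode-≤ : ∀ τ → ⌜ encode τ ⌝ ≤ τ

    sat      : ∀ n → Carrier (L n) → Type → Set
    sat-mono : ∀ n {x y} → x ⊑⟨ L n ⟩ y → ∀ τ → sat n x τ → sat n y τ
    sat-⋁    : ∀ n {I : Set} (x : I → Carrier (L n)) → Directed (L n) x → ∀ τ →
               sat n (⋁ (L n) x) τ → Σ[ i ∈ I ] sat n (x i) τ
    sat-≤    : ∀ n {x σ τ} → σ ≤ τ → sat n x σ → sat n x τ
    sat-ω    : ∀ n x → sat n x ω
    sat-∧    : ∀ n x {σ τ} → sat n x σ → sat n x τ → sat n x (σ ∧ τ)
    sat-emb  : ∀ n x τ → sat n x τ → sat (suc n) (proj₁ (emb n) x) τ

    sem       : ∀ n → Type → Carrier (L n)
    sem-anti  : ∀ n {σ τ} → σ ≤ τ → sem n τ ⊑⟨ L n ⟩ sem n σ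
    sem-prj   : ∀ n τ → _≈_ (L n) (proj₁ (prj n) (sem (suc n) τ)) (sem n τ)
    sat⇒sem⊑  : ∀ n x τ → sat n x τ → sem n τ ⊑⟨ L n ⟩ x
    sem-sat   : ∀ τ → Σ[ n ∈ ℕ ] sat n (sem n τ) τ
    sat-sem⇒≤ : ∀ n σ τ → sat n (sem n σ) τ → σ ≤ τ
    ⊑-⋁-sem   : ∀ n x → x ⊑⟨ L n ⟩ ⋁ (L n) {Σ[ s ∈ Code ] sat n x ⌜ s ⌝} (λ s → sem n ⌜ proj₁ s ⌝)

module LimitModelIso (M : LimitModel) where
  open LimitModel M
  open Filter

  Lim : Set₁
  Lim = Σ[ x ∈ ((n : ℕ) → Carrier (L n)) ] (∀ n → _≈_ (L n) (proj₁ (prj n) (x (suc n))) (x n))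

  LimPos : Pos (lsuc 0ℓ)
  LimPos = record { Elt = Lim ; _≤_ = λ x y → ∀ n → proj₁ x n ⊑⟨ L n ⟩ proj₁ y n }

  TypeFilter : Set₁
  TypeFilter = Filter Type _≤_ ω _∧_

  Members : TypeFilter → Set
  Members f = Σ[ s ∈ Code ] mem f ⌜ s ⌝

  semMembers : ∀ f n → Members f → Carrier (L n)
  semMembers f n (s , _) = sem n ⌜ s ⌝

  semMembers-directed : ∀ f n → Directed (L n) (semMembers f n)
  semMembers-directed f n =
    (encode ω , mem-up f (≤-encode ω) (mem-top f)) ,
    λ (s , s∈f) (t , t∈f) →
      (encode (⌜ s ⌝ ∧ ⌜ t ⌝) , mem-up f (≤-encode _) (mem-∧ f s∈f t∈f)) ,
      sem-anti n (≤-trans (encode-≤ _) ∧-≤ˡ) , sem-anti n (≤-trans (encode-≤ _) ∧-≤ʳ)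

  toLim : TypeFilter → Lim
  toLim f = (λ n → ⋁ (L n) (semMembers f n)) , λ n →
      ⊑-trans (L n) (cont (proj₂ (prj n)) (semMembers f (suc n)) (semMembers-directed f (suc n)))
        (⋁-⊑-⋁ (L n) _ (semMembers f n) λ s → s , proj₁ (sem-prj n ⌜ proj₁ s ⌝))
    , ⋁-least (L n) (semMembers f n) λ s →
        ⊑-trans (L n) (proj₂ (sem-prj n ⌜ proj₁ s ⌝))
          (mono (proj₂ (prj n)) (⋁-ub (L (suc n)) (semMembers f (suc n)) s))

  sat-lift : (x : Lim) {m n : ℕ} → m ≤′ n → ∀ τ → sat m (proj₁ x m) τ → sat n (proj₁ x n) τ
  sat-lift x ≤′-refl τ s = s
  sat-lift x {n = suc n} (≤′-step m≤n) τ s =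
    sat-mono (suc n) emb-xₙ⊑xₙ₊₁ τ (sat-emb n (proj₁ x n) τ (sat-lift x m≤n τ s))
    where
    emb-xₙ⊑xₙ₊₁ : proj₁ (emb n) (proj₁ x n) ⊑⟨ L (suc n) ⟩ proj₁ x (suc n)
    emb-xₙ⊑xₙ₊₁ = ⊑-trans (L (suc n)) (mono (proj₂ (emb n)) (proj₂ (proj₂ x n)))
                    (emb∘prj⊑id n (proj₁ x (suc n)))

  sem⊑-lower : (x : Lim) {m n : ℕ} → m ≤′ n → ∀ τ →
               sem n τ ⊑⟨ L n ⟩ proj₁ x n → sem m τ ⊑⟨ L m ⟩ proj₁ x m
  sem⊑-lower x ≤′-refl τ le = le
  sem⊑-lower x {n = suc n} (≤′-step m≤n) τ le = sem⊑-lower x m≤n τ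
    (⊑-trans (L n) (proj₂ (sem-prj n τ))
      (⊑-trans (L n) (mono (proj₂ (prj n)) le) (proj₁ (proj₂ x n))))

  fromLim : Lim → TypeFilter
  fromLim x = record
    { mem     = λ τ → Σ[ n ∈ ℕ ] sat n (proj₁ x n) τ
    ; mem-top = 0 , sat-ω 0 (proj₁ x 0)
    ; mem-up  = λ σ≤τ (n , s) → n , sat-≤ n σ≤τ s
    ; mem-∧   = λ {σ} {τ} (m , s) (n , t) →
        m ⊔ n , sat-∧ (m ⊔ n) (proj₁ x (m ⊔ n))
                  (sat-lift x (≤⇒≤′ (m≤m⊔n m n)) σ s) (sat-lift x (≤⇒≤′ (m≤n⊔m m n)) τ t)
    }

  fromLim-toLim⊆ : ∀ f τ → mem (fromLim (toLim f)) τ → mem f τ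
  fromLim-toLim⊆ f τ (n , s) =
    let ((σ , σ∈f) , sσ) = sat-⋁ n (semMembers f n) (semMembers-directed f n) τ s
    in mem-up f (sat-sem⇒≤ n ⌜ σ ⌝ τ sσ) σ∈f

  ⊆fromLim-toLim : ∀ f τ → mem f τ → mem (fromLim (toLim f)) τ
  ⊆fromLim-toLim f τ τ∈f =
    let (n , s) = sem-sat τ in
    n , sat-mono n (⊑-trans (L n) (sem-anti n (encode-≤ τ))
                     (⋁-ub (L n) (semMembers f n) (encode τ , mem-up f (≤-encode τ) τ∈f))) τ s

  toLim-fromLim⊑ : ∀ x n → proj₁ (toLim (fromLim x)) n ⊑⟨ L n ⟩ proj₁ x n
  toLim-fromLim⊑ x n = ⋁-least (L n) _ λ (s , m , sat-m) →
    sem⊑-lower x (≤⇒≤′ (m≤m⊔n n m)) ⌜ s ⌝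
      (sat⇒sem⊑ (n ⊔ m) _ ⌜ s ⌝ (sat-lift x (≤⇒≤′ (m≤n⊔m n m)) ⌜ s ⌝ sat-m))

  ⊑toLim-fromLim : ∀ x n → proj₁ x n ⊑⟨ L n ⟩ proj₁ (toLim (fromLim x)) n
  ⊑toLim-fromLim x n = ⊑-trans (L n) (⊑-⋁-sem n (proj₁ x n))
    (⋁-⊑-⋁ (L n) _ _ λ (s , sat-n) → (s , n , sat-n) , ⊑-refl (L n))

  filters≅limit : FilterPos Type _≤_ ω _∧_ ≅o LimPos
  filters≅limit = record
    { to        = toLim
    ; from      = fromLim
    ; to-mono   = λ {f} {g} f⊆g n → ⋁-⊑-⋁ (L n) (semMembers f n) (semMembers g n)
                    λ (s , s∈f) → (s , f⊆g _ s∈f) , ⊑-refl (L n)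
    ; from-mono = λ x≤y τ (n , s) → n , sat-mono n (x≤y n) τ s
    ; from-to   = λ f → fromLim-toLim⊆ f , ⊆fromLim-toLim f
    ; to-from   = λ x → toLim-fromLim⊑ x , ⊑toLim-fromLim x
    }

-- Types mention elements of R and so live in Set₁, while joins are indexed by sets: joins over
-- types are taken over codes, which name compact elements by their index in the enumeration.

data CodeR : Set where
  ψ#   : ℕ → CodeR
  ω#   : CodeR
  _∧#_ : CodeR → CodeR → CodeR

mutual
  data CodeD : Set where
    ψ#D   : ℕ → CodeD
    _↦#_  : CodeC → CodeR → CodeD
    ω#D   : CodeD
    _∧#D_ : CodeD → CodeD → CodeD

  data CodeC : Set where
    _⊗#_  : CodeD → CodeC → CodeC
    ω#C   : CodeC
    _∧#C_ : CodeC → CodeC → CodeC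

module _ (RR : OmegaAlgLattice) where
  open OmegaAlgLattice RR using (antisym; enum; enum-compact; enum-onto; algebraic)
  open Construction RR
  open CLat R using ()
    renaming (Carrier to |R|; _⊑_ to _⊑_; ⊑-refl to ⊑R-refl; ⊑-trans to ⊑R-trans;
              ⋁ to ⋁R; ⋁-ub to ⋁R-ub; ⋁-least to ⋁R-least)

  ⊥R-least : ∀ {a} → ⊥R ⊑ a
  ⊥R-least = ⋁R-least (λ ()) (λ ())

  ⊔R-upperˡ : ∀ {a b} → a ⊑ (a ⊔R b)
  ⊔R-upperˡ {a} {b} = ⋁R-ub (two a b) true

  ⊔R-upperʳ : ∀ {a b} → b ⊑ (a ⊔R b)
  ⊔R-upperʳ {a} {b} = ⋁R-ub (two a b) false

  ⊔R-least : ∀ {a b c} → a ⊑ c → b ⊑ c → (a ⊔R b) ⊑ c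
  ⊔R-least {a} {b} a⊑c b⊑c = ⋁R-least (two a b) λ { true → a⊑c ; false → b⊑c }

  ⊥R-compact : IsCompact R ⊥R
  ⊥R-compact x (i , _) _ = i , ⊥R-least

  ⊔R-compact : ∀ {a b} → IsCompact R a → IsCompact R b → IsCompact R (a ⊔R b)
  ⊔R-compact a-cpt b-cpt x x-dir a⊔b⊑⋁x =
    let (i , a⊑xi) = a-cpt x x-dir (⊑R-trans ⊔R-upperˡ a⊔b⊑⋁x)
        (j , b⊑xj) = b-cpt x x-dir (⊑R-trans ⊔R-upperʳ a⊔b⊑⋁x)
        (k , xi⊑xk , xj⊑xk) = proj₂ x-dir i j
    in k , ⊔R-least (⊑R-trans a⊑xi xi⊑xk) (⊑R-trans b⊑xj xj⊑xk)

  compacts⊑⇒⊑ : ∀ a {u} → (∀ r → IsCompact R r → r ⊑ a → r ⊑ u) → a ⊑ u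
  compacts⊑⇒⊑ a compacts⊑u with algebraic a
  ... | _ , x , x-cpt , _ , a≡⋁x = subst (_⊑ _) (sym a≡⋁x) (⋁R-least x λ i →
    compacts⊑u (x i) (x-cpt i) (subst (x i ⊑_) (sym a≡⋁x) (⋁R-ub x i)))

  record CompactSplit (r a b : |R|) : Set₁ where
    field
      r₁ r₂      : |R|
      r₁-compact : IsCompact R r₁
      r₂-compact : IsCompact R r₂
      r₁⊑a       : r₁ ⊑ a
      r₂⊑b       : r₂ ⊑ b
      r⊑r₁⊔r₂    : r ⊑ (r₁ ⊔R r₂)

  -- a ⊔ b is the directed join of the x i ⊔ y j, for compact approximations x of a and y of b.
  compact⊑⊔⇒split : ∀ {r} → IsCompact R r → ∀ a b → r ⊑ (a ⊔R b) → CompactSplit r a b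
  compact⊑⊔⇒split r-cpt a b r⊑a⊔b with algebraic a | algebraic b
  ... | I , x , x-cpt , (i₀ , x-up) , a≡⋁x | J , y , y-cpt , (j₀ , y-up) , b≡⋁y =
    let ((i , j) , r⊑xi⊔yj) = r-cpt z z-dir (⊑R-trans r⊑a⊔b a⊔b⊑⋁z) in
    record { r₁ = x i ; r₂ = y j ; r₁-compact = x-cpt i ; r₂-compact = y-cpt j
           ; r₁⊑a = subst (x i ⊑_) (sym a≡⋁x) (⋁R-ub x i)
           ; r₂⊑b = subst (y j ⊑_) (sym b≡⋁y) (⋁R-ub y j)
           ; r⊑r₁⊔r₂ = r⊑xi⊔yj }
    where
    z : I × J → |R|
    z (i , j) = x i ⊔R y j
    z-dir : Directed R z
    z-dir = (i₀ , j₀) , λ (i , j) (i' , j') →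
      let (k , xi⊑xk , xi'⊑xk) = x-up i i' ; (l , yj⊑yl , yj'⊑yl) = y-up j j' in
      (k , l) , ⊔R-least (⊑R-trans xi⊑xk ⊔R-upperˡ) (⊑R-trans yj⊑yl ⊔R-upperʳ)
              , ⊔R-least (⊑R-trans xi'⊑xk ⊔R-upperˡ) (⊑R-trans yj'⊑yl ⊔R-upperʳ)
    a⊔b⊑⋁z : (a ⊔R b) ⊑ ⋁R z
    a⊔b⊑⋁z = ⊔R-least
      (subst (_⊑ ⋁R z) (sym a≡⋁x) (⋁R-least x λ i → ⊑R-trans ⊔R-upperˡ (⋁R-ub z (i , j₀))))
      (subst (_⊑ ⋁R z) (sym b≡⋁y) (⋁R-least y λ j → ⊑R-trans ⊔R-upperʳ (⋁R-ub z (i₀ , j))))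

  -- The type language of R

  ⟦_⟧ : LR → |R|
  ⟦ ψ a _ ⟧  = a
  ⟦ ωR ⟧     = ⊥R
  ⟦ ρ ∧R σ ⟧ = ⟦ ρ ⟧ ⊔R ⟦ σ ⟧

  ⟦⟧-compact : ∀ ρ → IsCompact R ⟦ ρ ⟧
  ⟦⟧-compact (ψ _ a-cpt) = a-cpt
  ⟦⟧-compact ωR          = ⊥R-compact
  ⟦⟧-compact (ρ ∧R σ)    = ⊔R-compact (⟦⟧-compact ρ) (⟦⟧-compact σ)

  ⟦⟧-antitone : ∀ {ρ σ} → ρ ≤R σ → ⟦ σ ⟧ ⊑ ⟦ ρ ⟧
  ⟦⟧-antitone reflR            = ⊑R-refl
  ⟦⟧-antitone (transR ρ≤σ σ≤τ) = ⊑R-trans (⟦⟧-antitone σ≤τ) (⟦⟧-antitone ρ≤σ)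
  ⟦⟧-antitone ∧-lR             = ⊔R-upperˡ
  ⟦⟧-antitone ∧-rR             = ⊔R-upperʳ
  ⟦⟧-antitone ≤ωR              = ⊥R-least
  ⟦⟧-antitone (glbR ρ≤σ ρ≤τ)   = ⊔R-least (⟦⟧-antitone ρ≤σ) (⟦⟧-antitone ρ≤τ)
  ⟦⟧-antitone (ψ⊥≤ω _)         = ⊥R-least
  ⟦⟧-antitone (ω≤ψ⊥ _)         = ⊑R-refl
  ⟦⟧-antitone (ψ⊔≤ _ _ _)      = ⊑R-refl
  ⟦⟧-antitone (≤ψ⊔ _ _ _)      = ⊑R-refl

  -- Antisymmetry identifies b with a ⊔ b, so the rule ψ (a ⊔ b) ≤ ψ a ∧ ψ b applies.
  ψ-antitone : ∀ {a b} (a-cpt : IsCompact R a) (b-cpt : IsCompact R b) → a ⊑ b →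
               ψ b b-cpt ≤R ψ a a-cpt
  ψ-antitone {a} {b} a-cpt b-cpt a⊑b =
    subst (λ c → (c-cpt : IsCompact R c) → ψ c c-cpt ≤R ψ a a-cpt) (sym b≡b⊔a)
      (λ b⊔a-cpt → transR (ψ⊔≤ b-cpt a-cpt b⊔a-cpt) ∧-rR) b-cpt
    where
    b≡b⊔a : b ≡ (b ⊔R a)
    b≡b⊔a = antisym ⊔R-upperˡ (⊔R-least ⊑R-refl a⊑b)

  ψ-≡ : ∀ {a b} (a-cpt : IsCompact R a) (b-cpt : IsCompact R b) → a ≡ b → ψ a a-cpt ≤R ψ b b-cpt
  ψ-≡ a-cpt b-cpt refl = ψ-antitone b-cpt a-cpt ⊑R-refl

  ≤R-ψ⟦⟧ : ∀ ρ → ρ ≤R ψ ⟦ ρ ⟧ (⟦⟧-compact ρ)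
  ≤R-ψ⟦⟧ (ψ _ _)  = reflR
  ≤R-ψ⟦⟧ ωR       = ω≤ψ⊥ ⊥R-compact
  ≤R-ψ⟦⟧ (ρ ∧R σ) = transR (glbR (transR ∧-lR (≤R-ψ⟦⟧ ρ)) (transR ∧-rR (≤R-ψ⟦⟧ σ)))
                           (≤ψ⊔ (⟦⟧-compact ρ) (⟦⟧-compact σ) (⟦⟧-compact (ρ ∧R σ)))

  ψ⟦⟧-≤R : ∀ ρ → ψ ⟦ ρ ⟧ (⟦⟧-compact ρ) ≤R ρ
  ψ⟦⟧-≤R (ψ _ _)  = reflR
  ψ⟦⟧-≤R ωR       = ψ⊥≤ω ⊥R-compact
  ψ⟦⟧-≤R (ρ ∧R σ) = transR (ψ⊔≤ (⟦⟧-compact ρ) (⟦⟧-compact σ) (⟦⟧-compact (ρ ∧R σ)))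
                           (glbR (transR ∧-lR (ψ⟦⟧-≤R ρ)) (transR ∧-rR (ψ⟦⟧-≤R σ)))

  ⟦⟧⊑⇒ψ≤R : ∀ ρ {c} (c-cpt : IsCompact R c) → ⟦ ρ ⟧ ⊑ c → ψ c c-cpt ≤R ρ
  ⟦⟧⊑⇒ψ≤R ρ c-cpt ⟦ρ⟧⊑c = transR (ψ-antitone (⟦⟧-compact ρ) c-cpt ⟦ρ⟧⊑c) (ψ⟦⟧-≤R ρ)

  ⊑⟦⟧⇒≤Rψ : ∀ ρ {c} (c-cpt : IsCompact R c) → c ⊑ ⟦ ρ ⟧ → ρ ≤R ψ c c-cpt
  ⊑⟦⟧⇒≤Rψ ρ c-cpt c⊑⟦ρ⟧ = transR (≤R-ψ⟦⟧ ρ) (ψ-antitone c-cpt (⟦⟧-compact ρ) c⊑⟦ρ⟧)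

  ⟦⟧⊑⇒≤R : ∀ ρ σ → ⟦ ρ ⟧ ⊑ ⟦ σ ⟧ → σ ≤R ρ
  ⟦⟧⊑⇒≤R ρ σ ⟦ρ⟧⊑⟦σ⟧ = transR (≤R-ψ⟦⟧ σ) (⟦⟧⊑⇒ψ≤R ρ (⟦⟧-compact σ) ⟦ρ⟧⊑⟦σ⟧)

  ⌜_⌝R : CodeR → LR
  ⌜ ψ# n ⌝R   = ψ (enum n) (enum-compact n)
  ⌜ ω# ⌝R     = ωR
  ⌜ s ∧# t ⌝R = ⌜ s ⌝R ∧R ⌜ t ⌝R

  enum-index : ∀ {a} → IsCompact R a → ℕ
  enum-index {a} a-cpt = proj₁ (enum-onto a a-cpt)

  ψ-≤R-ψ# : ∀ {a} (a-cpt : IsCompact R a) → ψ a a-cpt ≤R ⌜ ψ# (enum-index a-cpt) ⌝R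
  ψ-≤R-ψ# {a} a-cpt = ψ-≡ a-cpt (enum-compact _) (sym (proj₂ (enum-onto a a-cpt)))

  ψ#-≤R-ψ : ∀ {a} (a-cpt : IsCompact R a) → ⌜ ψ# (enum-index a-cpt) ⌝R ≤R ψ a a-cpt
  ψ#-≤R-ψ {a} a-cpt = ψ-≡ (enum-compact _) a-cpt (proj₂ (enum-onto a a-cpt))

  encodeR : LR → CodeR
  encodeR (ψ _ a-cpt) = ψ# (enum-index a-cpt)
  encodeR ωR          = ω#
  encodeR (ρ ∧R σ)    = encodeR ρ ∧# encodeR σ

  ≤R-encodeR : ∀ ρ → ρ ≤R ⌜ encodeR ρ ⌝R
  ≤R-encodeR (ψ _ a-cpt) = ψ-≤R-ψ# a-cpt
  ≤R-encodeR ωR          = reflR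
  ≤R-encodeR (ρ ∧R σ)    = glbR (transR ∧-lR (≤R-encodeR ρ)) (transR ∧-rR (≤R-encodeR σ))

  encodeR-≤R : ∀ ρ → ⌜ encodeR ρ ⌝R ≤R ρ
  encodeR-≤R (ψ _ a-cpt) = ψ#-≤R-ψ a-cpt
  encodeR-≤R ωR          = reflR
  encodeR-≤R (ρ ∧R σ)    = glbR (transR ∧-lR (encodeR-≤R ρ)) (transR ∧-rR (encodeR-≤R σ))

  FilterR : Set₁
  FilterR = Filter LR _≤R_ ωR _∧R_

  open Filter

  MembersR : FilterR → Set
  MembersR f = Σ[ s ∈ CodeR ] mem f ⌜ s ⌝R

  ⟦Members⟧ : ∀ f → MembersR f → |R|
  ⟦Members⟧ f (s , _) = ⟦ ⌜ s ⌝R ⟧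

  ⟦Members⟧-directed : ∀ f → Directed R (⟦Members⟧ f)
  ⟦Members⟧-directed f =
    (ω# , mem-top f) , λ (s , s∈f) (t , t∈f) →
      (s ∧# t , mem-∧ f s∈f t∈f) , ⊔R-upperˡ , ⊔R-upperʳ

  toR : FilterR → |R|
  toR f = ⋁R (⟦Members⟧ f)

  fromR : |R| → FilterR
  fromR a = record
    { mem     = λ ρ → ⟦ ρ ⟧ ⊑ a
    ; mem-top = ⊥R-least
    ; mem-up  = λ ρ≤σ ⟦ρ⟧⊑a → ⊑R-trans (⟦⟧-antitone ρ≤σ) ⟦ρ⟧⊑a
    ; mem-∧   = ⊔R-least
    }

  ⊑toR-fromR : ∀ a → a ⊑ toR (fromR a)
  ⊑toR-fromR a = compacts⊑⇒⊑ a λ r r-cpt r⊑a →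
    let ρ = ψ r r-cpt in
    ⊑R-trans (⟦⟧-antitone (encodeR-≤R ρ))
      (⋁R-ub (⟦Members⟧ (fromR a)) (encodeR ρ , ⊑R-trans (⟦⟧-antitone (≤R-encodeR ρ)) r⊑a))

  filtersR≅R : FR ≅o RPos
  filtersR≅R = record
    { to        = toR
    ; from      = fromR
    ; to-mono   = λ {f} {g} f⊆g → ⋁R-least (⟦Members⟧ f) λ (s , s∈f) →
                    ⋁R-ub (⟦Members⟧ g) (s , f⊆g _ s∈f)
    ; from-mono = λ a⊑b ρ ⟦ρ⟧⊑a → ⊑R-trans ⟦ρ⟧⊑a a⊑b
    ; from-to   = λ f → (λ ρ ⟦ρ⟧⊑toRf →
                    let ((s , s∈f) , ⟦ρ⟧⊑⟦s⟧) = ⟦⟧-compact ρ _ (⟦Members⟧-directed f) ⟦ρ⟧⊑toRf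
                    in mem-up f (⟦⟧⊑⇒≤R ρ ⌜ s ⌝R ⟦ρ⟧⊑⟦s⟧) s∈f)
                  , (λ ρ ρ∈f → ⊑R-trans (⟦⟧-antitone (encodeR-≤R ρ))
                      (⋁R-ub (⟦Members⟧ f) (encodeR ρ , mem-up f (≤R-encodeR ρ) ρ∈f)))
    ; to-from   = λ a → ⋁R-least (⟦Members⟧ (fromR a)) proj₂ , ⊑toR-fromR a
    }

  -- The type languages of D and C

  π₁ : LC → LD
  π₁ (δ ⊗ _)   = δ
  π₁ ωC        = ωD
  π₁ (κ ∧C κ') = π₁ κ ∧D π₁ κ'

  π₂ : LC → LC
  π₂ (_ ⊗ κ)   = κ
  π₂ ωC        = ωC
  π₂ (κ ∧C κ') = π₂ κ ∧C π₂ κ'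

  π₁-mono : ∀ {κ κ'} → κ ≤C κ' → π₁ κ ≤D π₁ κ'
  π₁-mono reflC            = reflD
  π₁-mono (transC κ≤σ σ≤τ) = transD (π₁-mono κ≤σ) (π₁-mono σ≤τ)
  π₁-mono ∧-lC             = ∧-lD
  π₁-mono ∧-rC             = ∧-rD
  π₁-mono ≤ωC              = ≤ωD
  π₁-mono (glbC κ≤σ κ≤τ)   = glbD (π₁-mono κ≤σ) (π₁-mono κ≤τ)
  π₁-mono ω≤ω⊗ω            = reflD
  π₁-mono ⊗∧               = reflD
  π₁-mono (⊗mono δ≤δ' _)   = δ≤δ'

  π₂-mono : ∀ {κ κ'} → κ ≤C κ' → π₂ κ ≤C π₂ κ'
  π₂-mono reflC            = reflC
  π₂-mono (transC κ≤σ σ≤τ) = transC (π₂-mono κ≤σ) (π₂-mono σ≤τ)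
  π₂-mono ∧-lC             = ∧-lC
  π₂-mono ∧-rC             = ∧-rC
  π₂-mono ≤ωC              = ≤ωC
  π₂-mono (glbC κ≤σ κ≤τ)   = glbC (π₂-mono κ≤σ) (π₂-mono κ≤τ)
  π₂-mono ω≤ω⊗ω            = reflC
  π₂-mono ⊗∧               = reflC
  π₂-mono (⊗mono _ κ≤κ')   = κ≤κ'

  ≤C-π₁⊗π₂ : ∀ κ → κ ≤C (π₁ κ ⊗ π₂ κ)
  ≤C-π₁⊗π₂ (_ ⊗ _)   = reflC
  ≤C-π₁⊗π₂ ωC        = ω≤ω⊗ω
  ≤C-π₁⊗π₂ (κ ∧C κ') =
    transC (glbC (transC ∧-lC (≤C-π₁⊗π₂ κ)) (transC ∧-rC (≤C-π₁⊗π₂ κ'))) ⊗∧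

  π₁⊗π₂-≤C : ∀ κ → (π₁ κ ⊗ π₂ κ) ≤C κ
  π₁⊗π₂-≤C (_ ⊗ _)   = reflC
  π₁⊗π₂-≤C ωC        = ≤ωC
  π₁⊗π₂-≤C (κ ∧C κ') = glbC (transC (⊗mono ∧-lD ∧-lC) (π₁⊗π₂-≤C κ))
                            (transC (⊗mono ∧-rD ∧-rC) (π₁⊗π₂-≤C κ'))

  -- The types that hold of ⊥, i.e. those equivalent to ω; stage 0 satisfies exactly these.

  TrivialD : LD → Set
  TrivialD (ψD a _)  = a ⊑ ⊥R
  TrivialD (_ ↦ ρ)   = ⟦ ρ ⟧ ⊑ ⊥R
  TrivialD ωD        = ⊤
  TrivialD (δ ∧D δ') = TrivialD δ × TrivialD δ'

  TrivialC : LC → Set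
  TrivialC (δ ⊗ κ)   = TrivialD δ × TrivialC κ
  TrivialC ωC        = ⊤
  TrivialC (κ ∧C κ') = TrivialC κ × TrivialC κ'

  TrivialD-embR⁺ : ∀ ρ → ⟦ ρ ⟧ ⊑ ⊥R → TrivialD (embR ρ)
  TrivialD-embR⁺ (ψ _ _)   ρ⊑⊥ = ρ⊑⊥
  TrivialD-embR⁺ ωR        _   = tt
  TrivialD-embR⁺ (ρ ∧R ρ') ρ⊑⊥ = TrivialD-embR⁺ ρ (⊑R-trans ⊔R-upperˡ ρ⊑⊥)
                               , TrivialD-embR⁺ ρ' (⊑R-trans ⊔R-upperʳ ρ⊑⊥)

  TrivialD-embR⁻ : ∀ ρ → TrivialD (embR ρ) → ⟦ ρ ⟧ ⊑ ⊥R
  TrivialD-embR⁻ (ψ _ _)   t         = t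
  TrivialD-embR⁻ ωR        _         = ⊑R-refl
  TrivialD-embR⁻ (ρ ∧R ρ') (t , t') = ⊔R-least (TrivialD-embR⁻ ρ t) (TrivialD-embR⁻ ρ' t')

  mutual
    TrivialD-≤ : ∀ {δ δ'} → δ ≤D δ' → TrivialD δ → TrivialD δ'
    TrivialD-≤ reflD            t        = t
    TrivialD-≤ (transD δ≤σ σ≤τ) t        = TrivialD-≤ σ≤τ (TrivialD-≤ δ≤σ t)
    TrivialD-≤ ∧-lD             (t , _)  = t
    TrivialD-≤ ∧-rD             (_ , t)  = t
    TrivialD-≤ ≤ωD              _        = tt
    TrivialD-≤ (glbD δ≤σ δ≤τ)   t        = TrivialD-≤ δ≤σ t , TrivialD-≤ δ≤τ t
    TrivialD-≤ (liftR {ρ₁} {ρ₂} ρ₁≤ρ₂) t =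
      TrivialD-embR⁺ ρ₂ (⊑R-trans (⟦⟧-antitone ρ₁≤ρ₂) (TrivialD-embR⁻ ρ₁ t))
    TrivialD-≤ ω≤ω↦ω            _        = ⊑R-refl
    TrivialD-≤ (ψ≤ω↦ψ _)        t        = t
    TrivialD-≤ (ω↦ψ≤ψ _)        t        = t
    TrivialD-≤ ↦∧               (t , t') = ⊔R-least t t'
    TrivialD-≤ (↦mono _ ρ₁≤ρ₂)  t        = ⊑R-trans (⟦⟧-antitone ρ₁≤ρ₂) t

    TrivialC-≤ : ∀ {κ κ'} → κ ≤C κ' → TrivialC κ → TrivialC κ'
    TrivialC-≤ reflC            t        = t
    TrivialC-≤ (transC κ≤σ σ≤τ) t        = TrivialC-≤ σ≤τ (TrivialC-≤ κ≤σ t)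
    TrivialC-≤ ∧-lC             (t , _)  = t
    TrivialC-≤ ∧-rC             (_ , t)  = t
    TrivialC-≤ ≤ωC              _        = tt
    TrivialC-≤ (glbC κ≤σ κ≤τ)   t        = TrivialC-≤ κ≤σ t , TrivialC-≤ κ≤τ t
    TrivialC-≤ ω≤ω⊗ω            _        = tt , tt
    TrivialC-≤ ⊗∧ ((t₁ , u₁) , (t₂ , u₂)) = (t₁ , t₂) , (u₁ , u₂)
    TrivialC-≤ (⊗mono δ≤δ' κ≤κ') (t , u) = TrivialD-≤ δ≤δ' t , TrivialC-≤ κ≤κ' u

  TrivialC-π⁺ : ∀ κ → TrivialD (π₁ κ) → TrivialC (π₂ κ) → TrivialC κ
  TrivialC-π⁺ (_ ⊗ _)   t         u         = t , u
  TrivialC-π⁺ ωC        _         _         = tt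
  TrivialC-π⁺ (κ ∧C κ') (t , t') (u , u') = TrivialC-π⁺ κ t u , TrivialC-π⁺ κ' t' u'

  TrivialC-π⁻ : ∀ κ → TrivialC κ → TrivialD (π₁ κ) × TrivialC (π₂ κ)
  TrivialC-π⁻ (_ ⊗ _)   tu        = tu
  TrivialC-π⁻ ωC        _         = tt , tt
  TrivialC-π⁻ (κ ∧C κ') (tu , tu') =
    let (t , u) = TrivialC-π⁻ κ tu ; (t' , u') = TrivialC-π⁻ κ' tu' in (t , t') , (u , u')

  ωR-≤R-ψ : ∀ {r} (r-cpt : IsCompact R r) → r ⊑ ⊥R → ωR ≤R ψ r r-cpt
  ωR-≤R-ψ r-cpt r⊑⊥ = transR (ω≤ψ⊥ ⊥R-compact) (ψ-antitone r-cpt ⊥R-compact r⊑⊥)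

  TrivialD⇒ω≤D : ∀ δ → TrivialD δ → ωD ≤D δ
  TrivialD⇒ω≤D (ψD _ a-cpt) a⊑⊥    = liftR (ωR-≤R-ψ a-cpt a⊑⊥)
  TrivialD⇒ω≤D (_ ↦ ρ)      ρ⊑⊥    =
    transD ω≤ω↦ω (↦mono ≤ωC (transR (ω≤ψ⊥ ⊥R-compact) (⟦⟧⊑⇒ψ≤R ρ ⊥R-compact ρ⊑⊥)))
  TrivialD⇒ω≤D ωD           _      = reflD
  TrivialD⇒ω≤D (δ ∧D δ')    (t , t') = glbD (TrivialD⇒ω≤D δ t) (TrivialD⇒ω≤D δ' t')

  TrivialC⇒ω≤C : ∀ κ → TrivialC κ → ωC ≤C κ
  TrivialC⇒ω≤C (δ ⊗ κ)   (t , u)  = transC ω≤ω⊗ω (⊗mono (TrivialD⇒ω≤D δ t) (TrivialC⇒ω≤C κ u))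
  TrivialC⇒ω≤C ωC        _        = reflC
  TrivialC⇒ω≤C (κ ∧C κ') (u , u') = glbC (TrivialC⇒ω≤C κ u) (TrivialC⇒ω≤C κ' u')

  -- Satisfaction and least realisers at the finite stages

  mutual
    satC : ∀ n → Carrier (Cn n) → LC → Set
    satC zero    _       κ = TrivialC κ
    satC (suc n) (d , c) κ = satD n d (π₁ κ) × satC n c (π₂ κ)

    -- semC n ωC is the bottom of Cn n, so ψ a holds of d when a ⊑ d ⊥.
    satD : ∀ n → Carrier (Dn n) → LD → Set
    satD n d (ψD a _)  = a ⊑ proj₁ d (semC n ωC)
    satD n d (κ ↦ ρ)   = ⟦ ρ ⟧ ⊑ proj₁ d (semC n κ)
    satD n d ωD        = ⊤
    satD n d (δ ∧D δ') = satD n d δ × satD n d δ'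

    semC : ∀ n → LC → Carrier (Cn n)
    semC zero    _ = tt₁
    semC (suc n) κ = semD n (π₁ κ) , semC n (π₂ κ)

    semD : ∀ n → LD → Carrier (Dn n)
    semD n (ψD a _)  = constS (Cn n) R a
    semD n (κ ↦ ρ)   = step n κ ⟦ ρ ⟧
    semD n ωD        = constS (Cn n) R ⊥R
    semD n (δ ∧D δ') = ⋁⇒ (Cn n) R (λ b → if b then semD n δ else semD n δ')

    -- The step function (κ ⇒ r) c = (r if c satisfies κ, else ⊥), written as a join
    -- because satisfaction is not decidable.
    step-family : ∀ n κ → |R| → (c : Carrier (Cn n)) → ⊤ ⊎ satC n c κ → |R|
    step-family n κ r c (inj₁ _) = ⊥R
    step-family n κ r c (inj₂ _) = r

    step : ∀ n → LC → |R| → Carrier (Dn n)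
    step n κ r = (λ c → ⋁R (step-family n κ r c)) , record
      { mono = λ {c} {c'} c⊑c' → ⋁R-least (step-family n κ r c) λ
          { (inj₁ _) → ⊥R-least
          ; (inj₂ s) → ⋁R-ub (step-family n κ r c') (inj₂ (satC-mono n c⊑c' κ s)) }
      ; cont = λ x x-dir → ⋁R-least (step-family n κ r (⋁ (Cn n) x)) λ
          { (inj₁ _) → ⊥R-least
          ; (inj₂ s) → let (i , sᵢ) = satC-⋁ n x x-dir κ s in
              ⊑R-trans (⋁R-ub (step-family n κ r (x i)) (inj₂ sᵢ))
                       (⋁R-ub (λ i → ⋁R (step-family n κ r (x i))) i) } }

    satC-mono : ∀ n {c c'} → c ⊑⟨ Cn n ⟩ c' → ∀ κ → satC n c κ → satC n c' κ
    satC-mono zero    _         κ t       = t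
    satC-mono (suc n) (d⊑d' , c⊑c') κ (s , t) =
      satD-mono n d⊑d' (π₁ κ) s , satC-mono n c⊑c' (π₂ κ) t

    satD-mono : ∀ n {d d'} → d ⊑⟨ Dn n ⟩ d' → ∀ δ → satD n d δ → satD n d' δ
    satD-mono n d⊑d' (ψD _ _)  s        = ⊑R-trans s (d⊑d' _)
    satD-mono n d⊑d' (_ ↦ _)   s        = ⊑R-trans s (d⊑d' _)
    satD-mono n d⊑d' ωD        _        = tt
    satD-mono n d⊑d' (δ ∧D δ') (s , s') = satD-mono n d⊑d' δ s , satD-mono n d⊑d' δ' s'

    satC-⋁ : ∀ n {I : Set} (x : I → Carrier (Cn n)) → Directed (Cn n) x → ∀ κ →
             satC n (⋁ (Cn n) x) κ → Σ[ i ∈ I ] satC n (x i) κ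
    satC-⋁ zero    x (i₀ , _)  κ t       = i₀ , t
    satC-⋁ (suc n) x x-dir     κ (s , t) =
      let (i , sᵢ) = satD-⋁ n (λ i → proj₁ (x i)) (directed-proj₁ (Dn n) (Cn n) x x-dir) (π₁ κ) s
          (j , tⱼ) = satC-⋁ n (λ i → proj₂ (x i)) (directed-proj₂ (Dn n) (Cn n) x x-dir) (π₂ κ) t
          (k , xᵢ⊑xₖ , xⱼ⊑xₖ) = proj₂ x-dir i j
      in k , satD-mono n (proj₁ xᵢ⊑xₖ) (π₁ κ) sᵢ , satC-mono n (proj₂ xⱼ⊑xₖ) (π₂ κ) tⱼ

    satD-⋁ : ∀ n {I : Set} (x : I → Carrier (Dn n)) → Directed (Dn n) x → ∀ δ →
             satD n (⋁ (Dn n) x) δ → Σ[ i ∈ I ] satD n (x i) δ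
    satD-⋁ n x x-dir (ψD _ a-cpt) s = a-cpt _ (directed-app (Cn n) R x x-dir _) s
    satD-⋁ n x x-dir (_ ↦ ρ)      s = ⟦⟧-compact ρ _ (directed-app (Cn n) R x x-dir _) s
    satD-⋁ n x x-dir ωD           _ = proj₁ x-dir , tt
    satD-⋁ n x x-dir (δ ∧D δ') (s , s') =
      let (i , sᵢ) = satD-⋁ n x x-dir δ s
          (j , s'ⱼ) = satD-⋁ n x x-dir δ' s'
          (k , xᵢ⊑xₖ , xⱼ⊑xₖ) = proj₂ x-dir i j
      in k , satD-mono n xᵢ⊑xₖ δ sᵢ , satD-mono n xⱼ⊑xₖ δ' s'ⱼ

  step-upper : ∀ n κ r c → satC n c κ → r ⊑ proj₁ (step n κ r) c
  step-upper n κ r c s = ⋁R-ub (step-family n κ r c) (inj₂ s)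

  step-least : ∀ n κ r c {u} → (satC n c κ → r ⊑ u) → proj₁ (step n κ r) c ⊑ u
  step-least n κ r c r⊑u = ⋁R-least (step-family n κ r c) λ
    { (inj₁ _) → ⊥R-least ; (inj₂ s) → r⊑u s }

  step-directed : ∀ n κ r c → Directed R (step-family n κ r c)
  step-directed n κ r c = inj₁ tt , λ
    { (inj₁ _) (inj₁ _) → inj₁ tt , ⊑R-refl , ⊑R-refl
    ; (inj₁ _) (inj₂ s) → inj₂ s , ⊥R-least , ⊑R-refl
    ; (inj₂ s) (inj₁ _) → inj₂ s , ⊑R-refl , ⊥R-least
    ; (inj₂ s) (inj₂ _) → inj₂ s , ⊑R-refl , ⊑R-refl }

  satC-ω : ∀ n c → satC n c ωC
  satC-ω zero    _       = tt
  satC-ω (suc n) (_ , c) = tt , satC-ω n c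

  satC-∧ : ∀ n c {κ κ'} → satC n c κ → satC n c κ' → satC n c (κ ∧C κ')
  satC-∧ zero    _       t         t'         = t , t'
  satC-∧ (suc n) (_ , c) (s , t) (s' , t') = (s , s') , satC-∧ n c t t'

  semD-∧-upperˡ : ∀ n δ δ' → semD n δ ⊑⟨ Dn n ⟩ semD n (δ ∧D δ')
  semD-∧-upperˡ n δ δ' c = ⋁R-ub _ true

  semD-∧-upperʳ : ∀ n δ δ' → semD n δ' ⊑⟨ Dn n ⟩ semD n (δ ∧D δ')
  semD-∧-upperʳ n δ δ' c = ⋁R-ub _ false

  semD-∧-least : ∀ n δ δ' c {u} → proj₁ (semD n δ) c ⊑ u → proj₁ (semD n δ') c ⊑ u →
                 proj₁ (semD n (δ ∧D δ')) c ⊑ u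
  semD-∧-least n δ δ' c δ⊑u δ'⊑u = ⋁R-least _ λ { true → δ⊑u ; false → δ'⊑u }

  satD-embR⁺ : ∀ n d ρ → ⟦ ρ ⟧ ⊑ proj₁ d (semC n ωC) → satD n d (embR ρ)
  satD-embR⁺ n d (ψ _ _)   ρ⊑d = ρ⊑d
  satD-embR⁺ n d ωR        _   = tt
  satD-embR⁺ n d (ρ ∧R ρ') ρ⊑d = satD-embR⁺ n d ρ (⊑R-trans ⊔R-upperˡ ρ⊑d)
                               , satD-embR⁺ n d ρ' (⊑R-trans ⊔R-upperʳ ρ⊑d)

  satD-embR⁻ : ∀ n d ρ → satD n d (embR ρ) → ⟦ ρ ⟧ ⊑ proj₁ d (semC n ωC)
  satD-embR⁻ n d (ψ _ _)   s        = s
  satD-embR⁻ n d ωR        _        = ⊥R-least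
  satD-embR⁻ n d (ρ ∧R ρ') (s , s') = ⊔R-least (satD-embR⁻ n d ρ s) (satD-embR⁻ n d ρ' s')

  semD-embR⊑ : ∀ n ρ c → proj₁ (semD n (embR ρ)) c ⊑ ⟦ ρ ⟧
  semD-embR⊑ n (ψ _ _)   c = ⊑R-refl
  semD-embR⊑ n ωR        c = ⊑R-refl
  semD-embR⊑ n (ρ ∧R ρ') c = semD-∧-least n (embR ρ) (embR ρ') c
    (⊑R-trans (semD-embR⊑ n ρ c) ⊔R-upperˡ) (⊑R-trans (semD-embR⊑ n ρ' c) ⊔R-upperʳ)

  ⊑semD-embR : ∀ n ρ c → ⟦ ρ ⟧ ⊑ proj₁ (semD n (embR ρ)) c
  ⊑semD-embR n (ψ _ _)   c = ⊑R-refl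
  ⊑semD-embR n ωR        c = ⊑R-refl
  ⊑semD-embR n (ρ ∧R ρ') c = ⊔R-least
    (⊑R-trans (⊑semD-embR n ρ c) (semD-∧-upperˡ n (embR ρ) (embR ρ') c))
    (⊑R-trans (⊑semD-embR n ρ' c) (semD-∧-upperʳ n (embR ρ) (embR ρ') c))

  mutual
    satC-≤ : ∀ n {c κ κ'} → κ ≤C κ' → satC n c κ → satC n c κ'
    satC-≤ zero    κ≤κ' t       = TrivialC-≤ κ≤κ' t
    satC-≤ (suc n) κ≤κ' (s , t) = satD-≤ n (π₁-mono κ≤κ') s , satC-≤ n (π₂-mono κ≤κ') t

    semC-anti : ∀ n {κ κ'} → κ ≤C κ' → semC n κ' ⊑⟨ Cn n ⟩ semC n κ
    semC-anti zero    _    = tt₁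
    semC-anti (suc n) κ≤κ' = semD-anti n (π₁-mono κ≤κ') , semC-anti n (π₂-mono κ≤κ')

    satD-≤ : ∀ n {d δ δ'} → δ ≤D δ' → satD n d δ → satD n d δ'
    satD-≤ n reflD            s        = s
    satD-≤ n (transD δ≤σ σ≤τ) s        = satD-≤ n σ≤τ (satD-≤ n δ≤σ s)
    satD-≤ n ∧-lD             (s , _)  = s
    satD-≤ n ∧-rD             (_ , s)  = s
    satD-≤ n ≤ωD              _        = tt
    satD-≤ n (glbD δ≤σ δ≤τ)   s        = satD-≤ n δ≤σ s , satD-≤ n δ≤τ s
    satD-≤ n {d} (liftR {ρ₁} {ρ₂} ρ₁≤ρ₂) s =
      satD-embR⁺ n d ρ₂ (⊑R-trans (⟦⟧-antitone ρ₁≤ρ₂) (satD-embR⁻ n d ρ₁ s))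
    satD-≤ n ω≤ω↦ω            _        = ⊥R-least
    satD-≤ n (ψ≤ω↦ψ _)        s        = s
    satD-≤ n (ω↦ψ≤ψ _)        s        = s
    satD-≤ n ↦∧               (s , s') = ⊔R-least s s'
    satD-≤ n {d} (↦mono κ₂≤κ₁ ρ₁≤ρ₂) s =
      ⊑R-trans (⟦⟧-antitone ρ₁≤ρ₂) (⊑R-trans s (mono (proj₂ d) (semC-anti n κ₂≤κ₁)))

    semD-anti : ∀ n {δ δ'} → δ ≤D δ' → semD n δ' ⊑⟨ Dn n ⟩ semD n δ
    semD-anti n reflD                  c = ⊑R-refl
    semD-anti n (transD δ≤σ σ≤τ)       c = ⊑R-trans (semD-anti n σ≤τ c) (semD-anti n δ≤σ c)
    semD-anti n (∧-lD {σ} {τ})         c = semD-∧-upperˡ n σ τ c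
    semD-anti n (∧-rD {σ} {τ})         c = semD-∧-upperʳ n σ τ c
    semD-anti n ≤ωD                    c = ⊥R-least
    semD-anti n (glbD {_} {σ} {τ} δ≤σ δ≤τ) c =
      semD-∧-least n σ τ c (semD-anti n δ≤σ c) (semD-anti n δ≤τ c)
    semD-anti n (liftR {ρ₁} {ρ₂} ρ₁≤ρ₂) c =
      ⊑R-trans (semD-embR⊑ n ρ₂ c) (⊑R-trans (⟦⟧-antitone ρ₁≤ρ₂) (⊑semD-embR n ρ₁ c))
    semD-anti n ω≤ω↦ω                  c = step-least n ωC ⊥R c λ _ → ⊑R-refl
    semD-anti n (ψ≤ω↦ψ {a} _)          c = step-least n ωC a c λ _ → ⊑R-refl
    semD-anti n (ω↦ψ≤ψ {a} _)          c = step-upper n ωC a c (satC-ω n c)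
    semD-anti n (↦∧ {κ} {ρ₁} {ρ₂})     c = step-least n κ _ c λ s → ⊔R-least
      (⊑R-trans (step-upper n κ ⟦ ρ₁ ⟧ c s) (semD-∧-upperˡ n (κ ↦ ρ₁) (κ ↦ ρ₂) c))
      (⊑R-trans (step-upper n κ ⟦ ρ₂ ⟧ c s) (semD-∧-upperʳ n (κ ↦ ρ₁) (κ ↦ ρ₂) c))
    semD-anti n (↦mono {κ₁} {_} {ρ₁} κ₂≤κ₁ ρ₁≤ρ₂) c = step-least n _ _ c λ s →
      ⊑R-trans (⟦⟧-antitone ρ₁≤ρ₂) (step-upper n κ₁ ⟦ ρ₁ ⟧ c (satC-≤ n κ₂≤κ₁ s))

  iC∘jC⊑id : ∀ n c → proj₁ (iC n) (proj₁ (jC n) c) ⊑⟨ Cn (suc n) ⟩ c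
  iC∘jC⊑id zero    _       = (λ _ → ⊥R-least) , tt₁
  iC∘jC⊑id (suc n) (d , c) = (λ c' → mono (proj₂ d) (iC∘jC⊑id n c')) , iC∘jC⊑id n c

  satD-const⊥⁺ : ∀ n δ → TrivialD δ → satD n (constS (Cn n) R ⊥R) δ
  satD-const⊥⁺ n (ψD _ _)  t        = t
  satD-const⊥⁺ n (_ ↦ _)   t        = t
  satD-const⊥⁺ n ωD        _        = tt
  satD-const⊥⁺ n (δ ∧D δ') (t , t') = satD-const⊥⁺ n δ t , satD-const⊥⁺ n δ' t'

  satD-const⊥⁻ : ∀ n δ → satD n (constS (Cn n) R ⊥R) δ → TrivialD δ
  satD-const⊥⁻ n (ψD _ _)  s        = s
  satD-const⊥⁻ n (_ ↦ _)   s        = s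
  satD-const⊥⁻ n ωD        _        = tt
  satD-const⊥⁻ n (δ ∧D δ') (s , s') = satD-const⊥⁻ n δ s , satD-const⊥⁻ n δ' s'

  mutual
    satC-iC⁻ : ∀ n c κ → satC (suc n) (proj₁ (iC n) c) κ → satC n c κ
    satC-iC⁻ zero    _       κ (s , t) = TrivialC-π⁺ κ (satD-const⊥⁻ zero (π₁ κ) s) t
    satC-iC⁻ (suc n) (d , c) κ (s , t) = satD-eD⁻ n d (π₁ κ) s , satC-iC⁻ n c (π₂ κ) t

    satC-iC⁺ : ∀ n c κ → satC n c κ → satC (suc n) (proj₁ (iC n) c) κ
    satC-iC⁺ zero    _       κ t       = let (t₁ , t₂) = TrivialC-π⁻ κ t in
                                         satD-const⊥⁺ zero (π₁ κ) t₁ , t₂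
    satC-iC⁺ (suc n) (d , c) κ (s , t) = satD-eD⁺ n d (π₁ κ) s , satC-iC⁺ n c (π₂ κ) t

    satD-eD⁻ : ∀ n d δ → satD (suc n) (proj₁ (eD n) d) δ → satD n d δ
    satD-eD⁻ n d (ψD _ _)  s        = ⊑R-trans s (mono (proj₂ d) (jC-semC⊑semC n ωC))
    satD-eD⁻ n d (κ ↦ _)   s        = ⊑R-trans s (mono (proj₂ d) (jC-semC⊑semC n κ))
    satD-eD⁻ n d ωD        _        = tt
    satD-eD⁻ n d (δ ∧D δ') (s , s') = satD-eD⁻ n d δ s , satD-eD⁻ n d δ' s'

    satD-eD⁺ : ∀ n d δ → satD n d δ → satD (suc n) (proj₁ (eD n) d) δ
    satD-eD⁺ n d (ψD _ _)  s        = ⊑R-trans s (mono (proj₂ d) (semC⊑jC-semC n ωC))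
    satD-eD⁺ n d (κ ↦ _)   s        = ⊑R-trans s (mono (proj₂ d) (semC⊑jC-semC n κ))
    satD-eD⁺ n d ωD        _        = tt
    satD-eD⁺ n d (δ ∧D δ') (s , s') = satD-eD⁺ n d δ s , satD-eD⁺ n d δ' s'

    jC-semC⊑semC : ∀ n κ → proj₁ (jC n) (semC (suc n) κ) ⊑⟨ Cn n ⟩ semC n κ
    jC-semC⊑semC zero    _ = tt₁
    jC-semC⊑semC (suc n) κ = pD-semD⊑semD n (π₁ κ) , jC-semC⊑semC n (π₂ κ)

    semC⊑jC-semC : ∀ n κ → semC n κ ⊑⟨ Cn n ⟩ proj₁ (jC n) (semC (suc n) κ)
    semC⊑jC-semC zero    _ = tt₁
    semC⊑jC-semC (suc n) κ = semD⊑pD-semD n (π₁ κ) , semC⊑jC-semC n (π₂ κ)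

    pD-semD⊑semD : ∀ n δ → proj₁ (pD n) (semD (suc n) δ) ⊑⟨ Dn n ⟩ semD n δ
    pD-semD⊑semD n (ψD _ _)  c = ⊑R-refl
    pD-semD⊑semD n (κ ↦ ρ)   c = step-least (suc n) κ ⟦ ρ ⟧ _ λ s →
      step-upper n κ ⟦ ρ ⟧ c (satC-iC⁻ n c κ s)
    pD-semD⊑semD n ωD        c = ⊑R-refl
    pD-semD⊑semD n (δ ∧D δ') c = semD-∧-least (suc n) δ δ' _
      (⊑R-trans (pD-semD⊑semD n δ c) (semD-∧-upperˡ n δ δ' c))
      (⊑R-trans (pD-semD⊑semD n δ' c) (semD-∧-upperʳ n δ δ' c))

    semD⊑pD-semD : ∀ n δ → semD n δ ⊑⟨ Dn n ⟩ proj₁ (pD n) (semD (suc n) δ)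
    semD⊑pD-semD n (ψD _ _)  c = ⊑R-refl
    semD⊑pD-semD n (κ ↦ ρ)   c = step-least n κ ⟦ ρ ⟧ c λ s →
      step-upper (suc n) κ ⟦ ρ ⟧ _ (satC-iC⁺ n c κ s)
    semD⊑pD-semD n ωD        c = ⊑R-refl
    semD⊑pD-semD n (δ ∧D δ') c = semD-∧-least n δ δ' c
      (⊑R-trans (semD⊑pD-semD n δ c) (semD-∧-upperˡ (suc n) δ δ' _))
      (⊑R-trans (semD⊑pD-semD n δ' c) (semD-∧-upperʳ (suc n) δ δ' _))

  mutual
    satC⇒semC⊑ : ∀ n c κ → satC n c κ → semC n κ ⊑⟨ Cn n ⟩ c
    satC⇒semC⊑ zero    _       _ _       = tt₁
    satC⇒semC⊑ (suc n) (d , c) κ (s , t) = satD⇒semD⊑ n d (π₁ κ) s , satC⇒semC⊑ n c (π₂ κ) t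

    satD⇒semD⊑ : ∀ n d δ → satD n d δ → semD n δ ⊑⟨ Dn n ⟩ d
    satD⇒semD⊑ n d (ψD _ _) s c = ⊑R-trans s (mono (proj₂ d) (satC⇒semC⊑ n c ωC (satC-ω n c)))
    satD⇒semD⊑ n d (κ ↦ ρ)  s c = step-least n κ ⟦ ρ ⟧ c λ t →
      ⊑R-trans s (mono (proj₂ d) (satC⇒semC⊑ n c κ t))
    satD⇒semD⊑ n d ωD       _ c = ⊥R-least
    satD⇒semD⊑ n d (δ ∧D δ') (s , s') c =
      semD-∧-least n δ δ' c (satD⇒semD⊑ n d δ s c) (satD⇒semD⊑ n d δ' s' c)

  -- A type only becomes satisfiable by its realiser once the stage exceeds its ⊗-depth.
  mutual
    semC-sat : ∀ κ → Σ[ N ∈ ℕ ] (∀ n → N Nat.≤ n → satC n (semC n κ) κ)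
    semC-sat (δ ⊗ κ) =
      let (N₁ , h₁) = semD-sat δ ; (N₂ , h₂) = semC-sat κ in
      suc (N₁ ⊔ N₂) , λ { (suc n) N≤n → h₁ n (Nat.≤-trans (m≤m⊔n N₁ N₂) (s≤s⁻¹ N≤n))
                                       , h₂ n (Nat.≤-trans (m≤n⊔m N₁ N₂) (s≤s⁻¹ N≤n)) }
    semC-sat ωC = 0 , λ n _ → satC-ω n _
    semC-sat (κ ∧C κ') =
      let (N₁ , h₁) = semC-sat κ ; (N₂ , h₂) = semC-sat κ' in
      N₁ ⊔ N₂ , λ n N≤n → satC-∧ n _
        (satC-mono n (semC-anti n ∧-lC) κ (h₁ n (Nat.≤-trans (m≤m⊔n N₁ N₂) N≤n)))
        (satC-mono n (semC-anti n ∧-rC) κ' (h₂ n (Nat.≤-trans (m≤n⊔m N₁ N₂) N≤n)))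

    semD-sat : ∀ δ → Σ[ N ∈ ℕ ] (∀ n → N Nat.≤ n → satD n (semD n δ) δ)
    semD-sat (ψD _ _) = 0 , λ n _ → ⊑R-refl
    semD-sat (κ ↦ ρ)  = let (N , h) = semC-sat κ in
      N , λ n N≤n → step-upper n κ ⟦ ρ ⟧ (semC n κ) (h n N≤n)
    semD-sat ωD       = 0 , λ n _ → tt
    semD-sat (δ ∧D δ') =
      let (N₁ , h₁) = semD-sat δ ; (N₂ , h₂) = semD-sat δ' in
      N₁ ⊔ N₂ , λ n N≤n →
        satD-mono n (semD-anti n ∧-lD) δ (h₁ n (Nat.≤-trans (m≤m⊔n N₁ N₂) N≤n))
      , satD-mono n (semD-anti n ∧-rD) δ' (h₂ n (Nat.≤-trans (m≤n⊔m N₁ N₂) N≤n))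

  -- Completeness of the preorders
  ⊑semD⇒≤↦ : ∀ n τ c {r} (r-cpt : IsCompact R r) → r ⊑ proj₁ (semD n τ) c →
             Σ[ κ ∈ LC ] satC n c κ × τ ≤D (κ ↦ ψ r r-cpt)
  ⊑semD⇒≤↦ n (ψD _ b-cpt) c r-cpt r⊑b =
    ωC , satC-ω n c , transD (ψ≤ω↦ψ b-cpt) (↦mono reflC (ψ-antitone r-cpt b-cpt r⊑b))
  ⊑semD⇒≤↦ n (κ ↦ ρ) c r-cpt r⊑step with r-cpt _ (step-directed n κ ⟦ ρ ⟧ c) r⊑step
  ... | inj₁ _ , r⊑⊥ = ωC , satC-ω n c , transD ≤ωD (transD ω≤ω↦ω (↦mono reflC (ωR-≤R-ψ r-cpt r⊑⊥)))
  ... | inj₂ s , r⊑ρ = κ , s , ↦mono reflC (⊑⟦⟧⇒≤Rψ ρ r-cpt r⊑ρ)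
  ⊑semD⇒≤↦ n ωD c r-cpt r⊑⊥ =
    ωC , satC-ω n c , transD ≤ωD (transD ω≤ω↦ω (↦mono reflC (ωR-≤R-ψ r-cpt r⊑⊥)))
  ⊑semD⇒≤↦ n (τ ∧D τ') c r-cpt r⊑semD =
    let split = compact⊑⊔⇒split r-cpt _ _
                  (⊑R-trans r⊑semD (semD-∧-least n τ τ' c ⊔R-upperˡ ⊔R-upperʳ))
        open CompactSplit split
        (κ , s , τ≤κ↦r₁) = ⊑semD⇒≤↦ n τ c r₁-compact r₁⊑a
        (κ' , s' , τ'≤κ'↦r₂) = ⊑semD⇒≤↦ n τ' c r₂-compact r₂⊑b
        r₁⊔r₂-compact = ⊔R-compact r₁-compact r₂-compact
    in κ ∧C κ' , satC-∧ n c s s' ,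
       transD (glbD (transD ∧-lD (transD τ≤κ↦r₁ (↦mono ∧-lC reflR)))
                    (transD ∧-rD (transD τ'≤κ'↦r₂ (↦mono ∧-rC reflR))))
         (transD ↦∧ (↦mono reflC (transR (≤ψ⊔ r₁-compact r₂-compact r₁⊔r₂-compact)
                                         (ψ-antitone r-cpt r₁⊔r₂-compact r⊑r₁⊔r₂))))

  mutual
    satC-semC⇒≤C : ∀ n σ κ → satC n (semC n σ) κ → σ ≤C κ
    satC-semC⇒≤C zero    σ κ t       = transC ≤ωC (TrivialC⇒ω≤C κ t)
    satC-semC⇒≤C (suc n) σ κ (s , t) =
      transC (≤C-π₁⊗π₂ σ)
        (transC (⊗mono (satD-semD⇒≤D n (π₁ σ) (π₁ κ) s) (satC-semC⇒≤C n (π₂ σ) (π₂ κ) t))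
                (π₁⊗π₂-≤C κ))

    satD-semD⇒≤D : ∀ n τ δ → satD n (semD n τ) δ → τ ≤D δ
    satD-semD⇒≤D n τ (ψD _ a-cpt) s =
      let (κ , t , τ≤κ↦a) = ⊑semD⇒≤↦ n τ (semC n ωC) a-cpt s in
      transD τ≤κ↦a (transD (↦mono (satC-semC⇒≤C n ωC κ t) reflR) (ω↦ψ≤ψ a-cpt))
    satD-semD⇒≤D n τ (κ₀ ↦ ρ) s =
      let (κ , t , τ≤κ↦ρ) = ⊑semD⇒≤↦ n τ (semC n κ₀) (⟦⟧-compact ρ) s in
      transD τ≤κ↦ρ (↦mono (satC-semC⇒≤C n κ₀ κ t) (ψ⟦⟧-≤R ρ))
    satD-semD⇒≤D n τ ωD _ = ≤ωD
    satD-semD⇒≤D n τ (δ ∧D δ') (s , s') = glbD (satD-semD⇒≤D n τ δ s) (satD-semD⇒≤D n τ δ' s')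

  mutual
    ⌜_⌝D : CodeD → LD
    ⌜ ψ#D n ⌝D   = ψD (enum n) (enum-compact n)
    ⌜ k ↦# s ⌝D  = ⌜ k ⌝C ↦ ⌜ s ⌝R
    ⌜ ω#D ⌝D     = ωD
    ⌜ s ∧#D t ⌝D = ⌜ s ⌝D ∧D ⌜ t ⌝D

    ⌜_⌝C : CodeC → LC
    ⌜ s ⊗# k ⌝C  = ⌜ s ⌝D ⊗ ⌜ k ⌝C
    ⌜ ω#C ⌝C     = ωC
    ⌜ k ∧#C l ⌝C = ⌜ k ⌝C ∧C ⌜ l ⌝C

  mutual
    encodeD : LD → CodeD
    encodeD (ψD _ a-cpt) = ψ#D (enum-index a-cpt)
    encodeD (κ ↦ ρ)      = encodeC κ ↦# encodeR ρ
    encodeD ωD           = ω#D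
    encodeD (δ ∧D δ')    = encodeD δ ∧#D encodeD δ'

    encodeC : LC → CodeC
    encodeC (δ ⊗ κ)   = encodeD δ ⊗# encodeC κ
    encodeC ωC        = ω#C
    encodeC (κ ∧C κ') = encodeC κ ∧#C encodeC κ'

  mutual
    ≤D-encodeD : ∀ δ → δ ≤D ⌜ encodeD δ ⌝D
    ≤D-encodeD (ψD _ a-cpt) = liftR (ψ-≤R-ψ# a-cpt)
    ≤D-encodeD (κ ↦ ρ)      = ↦mono (encodeC-≤C κ) (≤R-encodeR ρ)
    ≤D-encodeD ωD           = reflD
    ≤D-encodeD (δ ∧D δ')    = glbD (transD ∧-lD (≤D-encodeD δ)) (transD ∧-rD (≤D-encodeD δ'))

    encodeD-≤D : ∀ δ → ⌜ encodeD δ ⌝D ≤D δ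
    encodeD-≤D (ψD _ a-cpt) = liftR (ψ#-≤R-ψ a-cpt)
    encodeD-≤D (κ ↦ ρ)      = ↦mono (≤C-encodeC κ) (encodeR-≤R ρ)
    encodeD-≤D ωD           = reflD
    encodeD-≤D (δ ∧D δ')    = glbD (transD ∧-lD (encodeD-≤D δ)) (transD ∧-rD (encodeD-≤D δ'))

    ≤C-encodeC : ∀ κ → κ ≤C ⌜ encodeC κ ⌝C
    ≤C-encodeC (δ ⊗ κ)   = ⊗mono (≤D-encodeD δ) (≤C-encodeC κ)
    ≤C-encodeC ωC        = reflC
    ≤C-encodeC (κ ∧C κ') = glbC (transC ∧-lC (≤C-encodeC κ)) (transC ∧-rC (≤C-encodeC κ'))

    encodeC-≤C : ∀ κ → ⌜ encodeC κ ⌝C ≤C κ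
    encodeC-≤C (δ ⊗ κ)   = ⊗mono (encodeD-≤D δ) (encodeC-≤C κ)
    encodeC-≤C ωC        = reflC
    encodeC-≤C (κ ∧C κ') = glbC (transC ∧-lC (encodeC-≤C κ)) (transC ∧-rC (encodeC-≤C κ'))

  -- Algebraicity of the finite stages

  semC-codes : ∀ n c → Σ[ k ∈ CodeC ] satC n c ⌜ k ⌝C → Carrier (Cn n)
  semC-codes n c (k , _) = semC n ⌜ k ⌝C

  semD-codes : ∀ n d → Σ[ s ∈ CodeD ] satD n d ⌜ s ⌝D → Carrier (Dn n)
  semD-codes n d (s , _) = semD n ⌜ s ⌝D

  semC-codes-directed : ∀ n c → Directed (Cn n) (semC-codes n c)
  semC-codes-directed n c = (ω#C , satC-ω n c) , λ (k , t) (l , u) →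
    (k ∧#C l , satC-∧ n c t u) , semC-anti n ∧-lC , semC-anti n ∧-rC

  mutual
    ⊑-⋁-semC : ∀ n c → c ⊑⟨ Cn n ⟩ ⋁ (Cn n) (semC-codes n c)
    ⊑-⋁-semC zero    _       = tt₁
    ⊑-⋁-semC (suc n) (d , c) = d⊑ , c⊑
      where
      realisers : Σ[ k ∈ CodeC ] satC (suc n) (d , c) ⌜ k ⌝C → Carrier (Cn (suc n))
      realisers = semC-codes (suc n) (d , c)

      d⊑ : d ⊑⟨ Dn n ⟩ proj₁ (⋁ (Cn (suc n)) realisers)
      d⊑ = ⊑-trans (Dn n) {d} {⋁ (Dn n) (semD-codes n d)} {proj₁ (⋁ (Cn (suc n)) realisers)}
        (⊑-⋁-semD n d)
        (⋁-⊑-⋁ (Dn n) (semD-codes n d) (λ i → proj₁ (realisers i)) λ (s , d⊨s) →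
          (s ⊗# ω#C , d⊨s , satC-ω n c) , ⊑-refl (Dn n) {semD n ⌜ s ⌝D})

      c⊑ : c ⊑⟨ Cn n ⟩ proj₂ (⋁ (Cn (suc n)) realisers)
      c⊑ = ⊑-trans (Cn n) (⊑-⋁-semC n c)
        (⋁-⊑-⋁ (Cn n) (semC-codes n c) (λ i → proj₂ (realisers i)) λ (k , c⊨k) →
          (ω#D ⊗# k , tt , c⊨k) , ⊑-refl (Cn n) {semC n ⌜ k ⌝C})

    -- By continuity d c is the join of the d (semC n κ) with c ⊨ κ, and a compact r below
    -- such a value is recorded by the type κ ↦ ψ r, which d satisfies.
    ⊑-⋁-semD : ∀ n d → d ⊑⟨ Dn n ⟩ ⋁ (Dn n) (semD-codes n d)
    ⊑-⋁-semD n d c =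
      ⊑R-trans (mono (proj₂ d) (⊑-⋁-semC n c))
        (⊑R-trans (cont (proj₂ d) (semC-codes n c) (semC-codes-directed n c))
          (⋁R-least _ λ (k , c⊨k) → compacts⊑⇒⊑ _ λ r r-cpt r⊑dk →
            let ρ = ψ r r-cpt
                d⊨k↦ρ = ⊑R-trans (⟦⟧-antitone (≤R-encodeR ρ)) r⊑dk
            in ⊑R-trans (⟦⟧-antitone (encodeR-≤R ρ))
                 (⊑R-trans (step-upper n ⌜ k ⌝C _ c c⊨k)
                   (⋁R-ub (λ s → proj₁ (semD-codes n d s) c) (k ↦# encodeR ρ , d⊨k↦ρ)))))

  modelD : LimitModel
  modelD = record
    { L = Dn ; emb = eD ; prj = pD
    ; emb∘prj⊑id = λ n g c → mono (proj₂ g) (iC∘jC⊑id n c)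
    ; Type = LD ; _≤_ = _≤D_ ; ω = ωD ; _∧_ = _∧D_
    ; ≤-trans = transD ; ∧-≤ˡ = ∧-lD ; ∧-≤ʳ = ∧-rD
    ; Code = CodeD ; ⌜_⌝ = ⌜_⌝D ; encode = encodeD ; ≤-encode = ≤D-encodeD ; encode-≤ = encodeD-≤D
    ; sat = satD ; sat-mono = satD-mono ; sat-⋁ = satD-⋁ ; sat-≤ = satD-≤
    ; sat-ω = λ _ _ → tt ; sat-∧ = λ _ _ → _,_ ; sat-emb = satD-eD⁺
    ; sem = semD ; sem-anti = semD-anti
    ; sem-prj = λ n δ → pD-semD⊑semD n δ , semD⊑pD-semD n δ
    ; sat⇒sem⊑ = satD⇒semD⊑
    ; sem-sat = λ δ → let (N , h) = semD-sat δ in N , h N Nat.≤-refl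
    ; sat-sem⇒≤ = satD-semD⇒≤D ; ⊑-⋁-sem = ⊑-⋁-semD
    }

  modelC : LimitModel
  modelC = record
    { L = Cn ; emb = iC ; prj = jC ; emb∘prj⊑id = iC∘jC⊑id
    ; Type = LC ; _≤_ = _≤C_ ; ω = ωC ; _∧_ = _∧C_
    ; ≤-trans = transC ; ∧-≤ˡ = ∧-lC ; ∧-≤ʳ = ∧-rC
    ; Code = CodeC ; ⌜_⌝ = ⌜_⌝C ; encode = encodeC ; ≤-encode = ≤C-encodeC ; encode-≤ = encodeC-≤C
    ; sat = satC ; sat-mono = satC-mono ; sat-⋁ = satC-⋁ ; sat-≤ = satC-≤
    ; sat-ω = satC-ω ; sat-∧ = satC-∧ ; sat-emb = satC-iC⁺
    ; sem = semC ; sem-anti = semC-anti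
    ; sem-prj = λ n κ → jC-semC⊑semC n κ , semC⊑jC-semC n κ
    ; sat⇒sem⊑ = satC⇒semC⊑
    ; sem-sat = λ κ → let (N , h) = semC-sat κ in N , h N Nat.≤-refl
    ; sat-sem⇒≤ = satC-semC⇒≤C ; ⊑-⋁-sem = ⊑-⋁-semC
    }

theorem3p21 : (RR : OmegaAlgLattice) →
    let open Construction RR in
    (FR ≅o RPos) × (FD ≅o DPos) × (FC ≅o CPos)
theorem3p21 RR =
  filtersR≅R RR , LimitModelIso.filters≅limit (modelD RR) , LimitModelIso.filters≅limit (modelC RR)
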